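{- Let $G$ be a $3$-non-compliant graph. Then for any two adjacent vertices $u,v$ of $G$, $|N_G(u)\cap N_G(v)|\ge 2$.
   Context: All graphs are finite, simple and undirected; $\overline{G}$ denotes the complement of $G$; $N_G(u)$ is the set of vertices adjacent to $u$. A minor of $G$ is a graph obtained from $G$ by a sequence of vertex deletions, edge deletions and edge contractions. $\Delta(H)$ is the maximum degree of $H$. A graph $G$ on $n$ vertices is $3$-non-compliant if neither $G$ nor $\overline{G}$ has a minor $H$ with $\Delta(H)\ge n-3$. -}

module Defs where

open import Data.Nat using (ℕ; zero; suc; _∸_; _≤_; _⊔_)
open import Data.Bool using (Bool; true; false; not; _∧_; _∨_; if_then_else_)
open import Data.Bool.Properties using (∧-comm; ∨-comm; ∧-zeroˡ; ∧-zeroʳ)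
open import Data.Fin using (Fin; punchIn)
open import Data.Fin.Properties using (_≟_)
open import Data.List using (List; map; foldr; allFin)
open import Data.Nat.ListAction using (sum)
open import Data.Product using (Σ; ∃; _×_; _,_)
open import Relation.Nullary using (¬_; does; yes; no)
open import Relation.Binary.PropositionalEquality using (_≡_; refl; sym; trans; cong; cong₂)

_==_ : ∀ {n} → Fin n → Fin n → Bool
x == y = does (x ≟ y)

==-sym : ∀ {n} (x y : Fin n) → (x == y) ≡ (y == x)
==-sym x y with x ≟ y | y ≟ x
... | yes _ | yes _ = refl
... | no _ | no _ = refl
... | yes p | no q = Data.Empty.⊥-elim (q (sym p)) where import Data.Empty
... | no p | yes q = Data.Empty.⊥-elim (p (sym q)) where import Data.Empty

==-refl : ∀ {n} (x : Fin n) → (x == x) ≡ true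
==-refl x with x ≟ x
... | yes _ = refl
... | no p = Data.Empty.⊥-elim (p refl) where import Data.Empty

record Graph (n : ℕ) : Set where
  field
    adj    : Fin n → Fin n → Bool
    adj-sym    : ∀ x y → adj x y ≡ adj y x
    irrefl : ∀ x → adj x x ≡ false
open Graph public

complement : ∀ {n} → Graph n → Graph n
complement G = record
  { adj = λ x y → not (x == y) ∧ not (adj G x y)
  ; adj-sym = λ x y → cong₂ (λ a b → not a ∧ not b) (==-sym x y) (adj-sym G x y)
  ; irrefl = λ x → cong (λ a → not a ∧ not (adj G x x)) (==-refl x)
  }

deleteVertex : ∀ {n} → Graph (suc n) → Fin (suc n) → Graph n
deleteVertex G j = record
  { adj = λ x y → adj G (punchIn j x) (punchIn j y)
  ; adj-sym = λ x y → adj-sym G (punchIn j x) (punchIn j y)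
  ; irrefl = λ x → irrefl G (punchIn j x)
  }

isPair : ∀ {n} → Fin n → Fin n → Fin n → Fin n → Bool
isPair i j x y = ((x == i) ∧ (y == j)) ∨ ((x == j) ∧ (y == i))

swap4 : ∀ a b c d → ((a ∧ b) ∨ (c ∧ d)) ≡ ((d ∧ c) ∨ (b ∧ a))
swap4 false false false false = refl
swap4 false false false true = refl
swap4 false false true false = refl
swap4 false false true true = refl
swap4 false true false false = refl
swap4 false true false true = refl
swap4 false true true false = refl
swap4 false true true true = refl
swap4 true false false false = refl
swap4 true false false true = refl
swap4 true false true false = refl
swap4 true false true true = refl
swap4 true true false false = refl
swap4 true true false true = refl
swap4 true true true false = refl
swap4 true true true true = refl

isPair-sym : ∀ {n} (i j x y : Fin n) → isPair i j x y ≡ isPair i j y x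
isPair-sym i j x y = swap4 (x == i) (y == j) (x == j) (y == i)

deleteEdge : ∀ {n} → Graph n → Fin n → Fin n → Graph n
deleteEdge G i j = record
  { adj = λ x y → adj G x y ∧ not (isPair i j x y)
  ; adj-sym = λ x y → cong₂ (λ a b → a ∧ not b) (adj-sym G x y) (isPair-sym i j x y)
  ; irrefl = λ x → cong (λ a → a ∧ not (isPair i j x x)) (irrefl G x)
  }

swap3 : ∀ a b c → (a ∨ b ∨ c) ≡ (a ∨ c ∨ b)
swap3 false false false = refl
swap3 false false true = refl
swap3 false true false = refl
swap3 false true true = refl
swap3 true false false = refl
swap3 true false true = refl
swap3 true true false = refl
swap3 true true true = refl

-- contraction of the edge {i,j}: j is merged into i (the resulting vertex set
-- is Fin n, identified with Fin (suc n) minus j via punchIn j)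
contract : ∀ {n} (G : Graph (suc n)) (i j : Fin (suc n)) → adj G i j ≡ true → Graph n
contract G i j _ = record
  { adj = A
  ; adj-sym = λ x y → cong₂ _∧_ (cong not (==-sym x y))
      (trans (swap3 (adj G (p x) (p y)) ((p x == i) ∧ adj G j (p y)) ((p y == i) ∧ adj G (p x) j))
        (trans (cong₂ (λ a b → a ∨ ((p y == i) ∧ b) ∨ ((p x == i) ∧ adj G j (p y)))
          (adj-sym G (p x) (p y)) (adj-sym G (p x) j))
          (cong (λ c → adj G (p y) (p x) ∨ ((p y == i) ∧ adj G j (p x)) ∨ ((p x == i) ∧ c))
          (adj-sym G j (p y)))))
  ; irrefl = λ x → cong (λ a → not a ∧ (adj G (p x) (p x) ∨ ((p x == i) ∧ adj G j (p x)) ∨ ((p x == i) ∧ adj G (p x) j))) (==-refl x)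
  }
  where
  p = punchIn j
  A : _ → _ → Bool
  A x y = not (x == y) ∧ (adj G (p x) (p y) ∨ ((p x == i) ∧ adj G j (p y)) ∨ ((p y == i) ∧ adj G (p x) j))

data _≼_ {m : ℕ} (H : Graph m) : ∀ {n} → Graph n → Set where
  ≼-refl    : H ≼ H
  ≼-delV    : ∀ {n} {G : Graph (suc n)} (j : Fin (suc n)) → H ≼ deleteVertex G j → H ≼ G
  ≼-delE    : ∀ {n} {G : Graph n} (i j : Fin n) → H ≼ deleteEdge G i j → H ≼ G
  ≼-contract : ∀ {n} {G : Graph (suc n)} (i j : Fin (suc n)) (e : adj G i j ≡ true) →
               H ≼ contract G i j e → H ≼ G

deg : ∀ {n} → Graph n → Fin n → ℕ
deg G u = sum (map (λ v → if adj G u v then 1 else 0) (allFin _))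

Δ : ∀ {n} → Graph n → ℕ
Δ G = foldr _⊔_ 0 (map (deg G) (allFin _))

HasBigMinor : ∀ {n} → Graph n → Set
HasBigMinor {n} G = Σ ℕ (λ m → Σ (Graph m) (λ H → H ≼ G × n ∸ 3 ≤ Δ H))

NonCompliant3 : ∀ {n} → Graph n → Set
NonCompliant3 G = ¬ HasBigMinor G × ¬ HasBigMinor (complement G)

commonNbrs : ∀ {n} → Graph n → Fin n → Fin n → ℕ
commonNbrs G u v = sum (map (λ w → if adj G u w ∧ adj G v w then 1 else 0) (allFin _))

{-# OPTIONS --safe #-}
-- Suppose the edge uv has at most one common neighbour, and call d far if it is adjacent
-- neither to u, nor to v, nor to any common neighbour. If some d is far, the path u–d–v of
-- the complement dominates it: every other vertex misses u, misses v, or is a common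
-- neighbour and so misses d. Otherwise the path u–v–c (c the common neighbour), or the
-- edge uv if there is none, dominates G. Contracting a dominating path on three vertices
-- (an edge) of an n-vertex graph leaves a vertex of degree n - 3 (n - 2), so G or its
-- complement has a minor of maximum degree at least n - 3.
module Submission where

open import Defs
open import Data.Nat using (ℕ; _≤_)
open import Data.Fin using (Fin)
open import Data.Bool using (true)
open import Relation.Binary.PropositionalEquality using (_≡_)

open import Data.Nat using (zero; suc; _+_; _∸_; _⊔_; s≤s; z≤n; _≤?_)
open import Data.Nat.Properties using (≤-trans; m≤n+m; m≤m⊔n; m≤n⊔m; ∸-monoʳ-≤; module ≤-Reasoning)
open import Data.Fin using (zero; suc; punchIn; punchOut)
open import Data.Fin.Properties using (_≟_; punchIn-injective; punchInᵢ≢i; punchIn-punchOut; suc-injective; any?; all?)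
open import Data.Bool using (Bool; false; not; _∧_; if_then_else_)
open import Data.Bool.Properties as Bool using (∨-zeroʳ; ¬-not)
open import Data.List using (List; map; foldr; tabulate)
open import Data.List.Membership.Propositional using (_∈_)
open import Data.List.Membership.Propositional.Properties using (∈-allFin)
open import Data.List.Relation.Unary.Any using (here; there)
open import Data.Nat.ListAction using (sum)
open import Data.Product using (Σ; ∃; _×_; _,_)
open import Data.Sum using (_⊎_; inj₁; inj₂)
open import Data.Empty using (⊥-elim)
open import Function using (_∘_; id; case_of_)
open import Relation.Nullary using (¬_; yes; no)
open import Relation.Nullary.Decidable using (dec-false; _×-dec_; _→-dec_)
open import Relation.Unary using (Decidable)
open import Relation.Binary.PropositionalEquality using (refl; sym; trans; cong; cong₂; subst; _≢_)

count : ∀ m → (Fin m → Bool) → ℕ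
count zero    P = 0
count (suc m) P = (if P zero then 1 else 0) + count m (P ∘ suc)

sum-indicator-tabulate : ∀ {A : Set} m (f : Fin m → A) (P : A → Bool) →
                         sum (map (λ x → if P x then 1 else 0) (tabulate f)) ≡ count m (P ∘ f)
sum-indicator-tabulate zero    f P = refl
sum-indicator-tabulate (suc m) f P =
  cong ((if P (f zero) then 1 else 0) +_) (sum-indicator-tabulate m (f ∘ suc) P)

count-full : ∀ m (P : Fin m → Bool) → (∀ y → P y ≡ true) → count m P ≡ m
count-full zero    P all = refl
count-full (suc m) P all rewrite all zero = cong suc (count-full m (P ∘ suc) (all ∘ suc))

count-allBut : ∀ m (P : Fin m → Bool) (x : Fin m) → (∀ y → x ≢ y → P y ≡ true) → m ∸ 1 ≤ count m P
count-allBut (suc m) P zero all rewrite count-full m (P ∘ suc) (λ y → all (suc y) λ ()) = m≤n+m m _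
count-allBut (suc (suc m)) P (suc x) all rewrite all zero (λ ()) =
  s≤s (count-allBut (suc m) (P ∘ suc) x (λ y x≢y → all (suc y) (x≢y ∘ suc-injective)))

count-pos : ∀ m (P : Fin m → Bool) (a : Fin m) → P a ≡ true → 1 ≤ count m P
count-pos (suc m) P zero    Pa rewrite Pa = s≤s z≤n
count-pos (suc m) P (suc a) Pa = ≤-trans (count-pos m (P ∘ suc) a Pa) (m≤n+m _ _)

count-two : ∀ m (P : Fin m → Bool) (a b : Fin m) → a ≢ b → P a ≡ true → P b ≡ true → 2 ≤ count m P
count-two (suc m) P zero    zero    a≢b Pa Pb = ⊥-elim (a≢b refl)
count-two (suc m) P zero    (suc b) a≢b Pa Pb rewrite Pa = s≤s (count-pos m (P ∘ suc) b Pb)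
count-two (suc m) P (suc a) zero    a≢b Pa Pb rewrite Pb = s≤s (count-pos m (P ∘ suc) a Pa)
count-two (suc m) P (suc a) (suc b) a≢b Pa Pb =
  ≤-trans (count-two m (P ∘ suc) a b (a≢b ∘ cong suc) Pa Pb) (m≤n+m _ _)

≤-foldr-⊔ : ∀ {A : Set} (f : A → ℕ) {x : A} {xs : List A} → x ∈ xs → f x ≤ foldr _⊔_ 0 (map f xs)
≤-foldr-⊔ f (here refl) = m≤m⊔n _ _
≤-foldr-⊔ f (there x∈xs) = ≤-trans (≤-foldr-⊔ f x∈xs) (m≤n⊔m _ _)

adj⇒≢ : ∀ {n} (G : Graph n) {x y : Fin n} → adj G x y ≡ true → x ≢ y
adj⇒≢ G {x} xy refl = case trans (sym xy) (irrefl G x) of λ ()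

complement-adj : ∀ {n} (G : Graph n) {x y : Fin n} → x ≢ y → adj G x y ≡ false → adj (complement G) x y ≡ true
complement-adj G {x} {y} x≢y xy = cong₂ (λ a b → not a ∧ not b) (dec-false (x ≟ y) x≢y) xy

Dominating : ∀ {m} → Graph m → Fin m → Set
Dominating H x = ∀ y → x ≢ y → adj H x y ≡ true

deg≤Δ : ∀ {m} (H : Graph m) (x : Fin m) → deg H x ≤ Δ H
deg≤Δ H x = ≤-foldr-⊔ (deg H) (∈-allFin x)

dominating⇒Δ≥ : ∀ {m} (H : Graph m) {x : Fin m} → Dominating H x → m ∸ 1 ≤ Δ H
dominating⇒Δ≥ {m} H {x} dom = begin
  m ∸ 1             ≤⟨ count-allBut m (adj H x) x dom ⟩
  count m (adj H x) ≡⟨ sym (sum-indicator-tabulate m id (adj H x)) ⟩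
  deg H x           ≤⟨ deg≤Δ H x ⟩
  Δ H               ∎
  where open ≤-Reasoning

_HasMinorWithΔ≥_ : ∀ {n} → Graph n → ℕ → Set
G HasMinorWithΔ≥ d = Σ ℕ λ m → Σ (Graph m) λ H → H ≼ G × d ≤ Δ H

HasMinorWithΔ≥-mono : ∀ {n} (G : Graph n) {d d′ : ℕ} → d ≤ d′ → G HasMinorWithΔ≥ d′ → G HasMinorWithΔ≥ d
HasMinorWithΔ≥-mono G d≤d′ (m , H , H≼G , d′≤Δ) = m , H , H≼G , ≤-trans d≤d′ d′≤Δ

dominating⇒minor : ∀ {m} (H : Graph m) {x : Fin m} → Dominating H x → H HasMinorWithΔ≥ (m ∸ 1)
dominating⇒minor {m} H dom = m , H , ≼-refl , dominating⇒Δ≥ H dom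

punchIn≢ : ∀ {n} {j a : Fin (suc n)} (j≢a : j ≢ a) {q : Fin n} → q ≢ punchOut j≢a → punchIn j q ≢ a
punchIn≢ {j = j} j≢a q≢ q↑≡a = q≢ (punchIn-injective j _ _ (trans q↑≡a (sym (punchIn-punchOut j≢a))))

module Contraction {n} (G : Graph (suc n)) {i j : Fin (suc n)} (ij : adj G i j ≡ true) where

  G/ij : Graph n
  G/ij = contract G i j ij

  j≢i : j ≢ i
  j≢i = adj⇒≢ G ij ∘ sym

  merged : Fin n
  merged = punchOut j≢i

  punchIn-merged : punchIn j merged ≡ i
  punchIn-merged = punchIn-punchOut j≢i

  contract-adj-kept : ∀ {x y} → x ≢ y → adj G (punchIn j x) (punchIn j y) ≡ true → adj G/ij x y ≡ true
  contract-adj-kept {x} {y} x≢y xy rewrite dec-false (x ≟ y) x≢y | xy = refl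

  contract-adj-merged : ∀ {y} → merged ≢ y →
                        adj G i (punchIn j y) ≡ true ⊎ adj G j (punchIn j y) ≡ true → adj G/ij merged y ≡ true
  contract-adj-merged m≢y (inj₁ iy) =
    contract-adj-kept m≢y (subst (λ z → adj G z _ ≡ true) (sym punchIn-merged) iy)
  contract-adj-merged {y} m≢y (inj₂ jy)
    rewrite dec-false (merged ≟ y) m≢y | punchIn-merged | ==-refl i | jy = ∨-zeroʳ (adj G i (punchIn j y))

  dominatingEdge : (∀ q → q ≢ i → q ≢ j → adj G i q ≡ true ⊎ adj G j q ≡ true) → Dominating G/ij merged
  dominatingEdge cover y m≢y = contract-adj-merged m≢y
    (cover (punchIn j y) (punchIn≢ j≢i (m≢y ∘ sym)) (punchInᵢ≢i j y))

  HasMinorWithΔ≥-lift : ∀ {d} → G/ij HasMinorWithΔ≥ d → G HasMinorWithΔ≥ d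
  HasMinorWithΔ≥-lift (m , H , H≼G/ij , d≤Δ) = m , H , ≼-contract i j ij H≼G/ij , d≤Δ

  dominatingEdge⇒minor : (∀ q → q ≢ i → q ≢ j → adj G i q ≡ true ⊎ adj G j q ≡ true) →
                         G HasMinorWithΔ≥ (suc n ∸ 2)
  dominatingEdge⇒minor cover = HasMinorWithΔ≥-lift (dominating⇒minor G/ij (dominatingEdge cover))

dominatingPath⇒minor : ∀ {n} (G : Graph (suc n)) {i j k : Fin (suc n)} (ij : adj G i j ≡ true) →
                       adj G i k ≡ true ⊎ adj G j k ≡ true → k ≢ i → k ≢ j →
                       (∀ q → q ≢ i → q ≢ j → q ≢ k →
                          adj G i q ≡ true ⊎ adj G j q ≡ true ⊎ adj G k q ≡ true) →
                       G HasMinorWithΔ≥ (suc n ∸ 3)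
dominatingPath⇒minor {zero} G {zero} {k = zero} ij ijk k≢i k≢j cover = ⊥-elim (k≢i refl)
dominatingPath⇒minor {suc n} G {i} {j} {k} ij ijk k≢i k≢j cover =
  HasMinorWithΔ≥-lift (Contraction.dominatingEdge⇒minor G/ij merged-k′ cover′)
  where
  open Contraction G ij

  j≢k : j ≢ k
  j≢k = k≢j ∘ sym

  k′ : Fin (suc n)
  k′ = punchOut j≢k

  punchIn-k′ : punchIn j k′ ≡ k
  punchIn-k′ = punchIn-punchOut j≢k

  merged≢k′ : merged ≢ k′
  merged≢k′ m≡k′ = k≢i (trans (sym punchIn-k′) (trans (cong (punchIn j) (sym m≡k′)) punchIn-merged))

  merged-k′ : adj G/ij merged k′ ≡ true
  merged-k′ = contract-adj-merged merged≢k′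
    (subst (λ z → adj G i z ≡ true ⊎ adj G j z ≡ true) (sym punchIn-k′) ijk)

  cover′ : ∀ q → q ≢ merged → q ≢ k′ → adj G/ij merged q ≡ true ⊎ adj G/ij k′ q ≡ true
  cover′ q q≢m q≢k′ with cover (punchIn j q) (punchIn≢ j≢i q≢m) (punchInᵢ≢i j q) (punchIn≢ j≢k q≢k′)
  ... | inj₁ iq        = inj₁ (contract-adj-merged (q≢m ∘ sym) (inj₁ iq))
  ... | inj₂ (inj₁ jq) = inj₁ (contract-adj-merged (q≢m ∘ sym) (inj₂ jq))
  ... | inj₂ (inj₂ kq) =
    inj₂ (contract-adj-kept (q≢k′ ∘ sym) (subst (λ z → adj G z (punchIn j q) ≡ true) (sym punchIn-k′) kq))

CommonNbr : ∀ {n} → Graph n → Fin n → Fin n → Fin n → Set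
CommonNbr G u v w = adj G u w ≡ true × adj G v w ≡ true

commonNbrs≥2 : ∀ {n} (G : Graph n) {u v a b : Fin n} → a ≢ b →
               CommonNbr G u v a → CommonNbr G u v b → 2 ≤ commonNbrs G u v
commonNbrs≥2 {n} G {u} {v} {a} {b} a≢b (ua , va) (ub , vb) =
  subst (2 ≤_) (sym (sum-indicator-tabulate n id common))
        (count-two n common a b a≢b (cong₂ _∧_ ua va) (cong₂ _∧_ ub vb))
  where
  common : Fin n → Bool
  common w = adj G u w ∧ adj G v w

commonNbr-unique : ∀ {n} (G : Graph n) {u v : Fin n} → ¬ 2 ≤ commonNbrs G u v →
                   ∀ {a b} → CommonNbr G u v a → CommonNbr G u v b → a ≡ b
commonNbr-unique G 2≰ {a} {b} ua va with a ≟ b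
... | yes a≡b = a≡b
... | no a≢b  = ⊥-elim (2≰ (commonNbrs≥2 G a≢b ua va))

module AdjacentPair {n} (G : Graph (suc n)) {u v : Fin (suc n)} (uv : adj G u v ≡ true) where

  Far : Fin (suc n) → Set
  Far d = adj G u d ≡ false × adj G v d ≡ false × (∀ w → CommonNbr G u v w → adj G d w ≡ false)

  far? : Decidable Far
  far? d = (adj G u d Bool.≟ false) ×-dec (adj G v d Bool.≟ false) ×-dec
           all? (λ w → ((adj G u w Bool.≟ true) ×-dec (adj G v w Bool.≟ true)) →-dec (adj G d w Bool.≟ false))

  far⇒complementMinor : ∀ {d} → Far d → HasBigMinor (complement G)
  far⇒complementMinor {d} (ud , vd , d≁common) =
    dominatingPath⇒minor (complement G) (complement-adj G (d≢u ∘ sym) ud)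
      (inj₂ (complement-adj G d≢v (trans (adj-sym G d v) vd))) (adj⇒≢ G uv ∘ sym) (d≢v ∘ sym) cover
    where
    d≢u : d ≢ u
    d≢u refl = case trans (sym vd) (trans (adj-sym G v u) uv) of λ ()

    d≢v : d ≢ v
    d≢v refl = case trans (sym ud) uv of λ ()

    cover : ∀ q → q ≢ u → q ≢ d → q ≢ v →
            adj (complement G) u q ≡ true ⊎ adj (complement G) d q ≡ true ⊎ adj (complement G) v q ≡ true
    cover q q≢u q≢d q≢v with adj G u q Bool.≟ false | adj G v q Bool.≟ false
    ... | yes uq | _      = inj₁ (complement-adj G (q≢u ∘ sym) uq)
    ... | no _   | yes vq = inj₂ (inj₂ (complement-adj G (q≢v ∘ sym) vq))
    ... | no uq  | no vq  = inj₂ (inj₁ (complement-adj G (q≢d ∘ sym) (d≁common q (¬-not uq , ¬-not vq))))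

  noFar⇒minor : ¬ ∃ Far → (∀ {a b} → CommonNbr G u v a → CommonNbr G u v b → a ≡ b) → HasBigMinor G
  noFar⇒minor noFar unique with any? (λ c → (adj G u c Bool.≟ true) ×-dec (adj G v c Bool.≟ true))
  ... | yes (c , uc , vc) =
    dominatingPath⇒minor G uv (inj₁ uc) (adj⇒≢ G uc ∘ sym) (adj⇒≢ G vc ∘ sym) cover
    where
    -- An undominated vertex is far.
    cover : ∀ q → q ≢ u → q ≢ v → q ≢ c → adj G u q ≡ true ⊎ adj G v q ≡ true ⊎ adj G c q ≡ true
    cover q _ _ _ with adj G u q in uq | adj G v q in vq | adj G c q in cq
    ... | true  | _     | _     = inj₁ refl
    ... | false | true  | _     = inj₂ (inj₁ refl)
    ... | false | false | true  = inj₂ (inj₂ refl)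
    ... | false | false | false = ⊥-elim (noFar (q , uq , vq , λ w common →
          subst (λ z → adj G q z ≡ false) (unique (uc , vc) common) (trans (adj-sym G q c) cq)))
  ... | no noCommon =
    HasMinorWithΔ≥-mono G (∸-monoʳ-≤ (suc n) (s≤s (s≤s z≤n))) (Contraction.dominatingEdge⇒minor G uv cover)
    where
    cover : ∀ q → q ≢ u → q ≢ v → adj G u q ≡ true ⊎ adj G v q ≡ true
    cover q _ _ with adj G u q in uq | adj G v q in vq
    ... | true  | _     = inj₁ refl
    ... | false | true  = inj₂ refl
    ... | false | false = ⊥-elim (noFar (q , uq , vq , λ w common → ⊥-elim (noCommon (w , common))))

open AdjacentPair using (far?; far⇒complementMinor; noFar⇒minor)

lemma4 : ∀ {n} (G : Graph n) → NonCompliant3 G →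
    ∀ (u v : Fin n) → adj G u v ≡ true → 2 ≤ commonNbrs G u v
lemma4 {zero}  G _ () v uv
lemma4 {suc n} G (¬minor , ¬coMinor) u v uv with 2 ≤? commonNbrs G u v
... | yes 2≤ = 2≤
... | no 2≰ with any? (far? G uv)
...   | yes (d , far) = ⊥-elim (¬coMinor (far⇒complementMinor G uv far))
...   | no noFar      = ⊥-elim (¬minor (noFar⇒minor G uv noFar (commonNbr-unique G 2≰)))
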